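{- Assume $\Omega$ is finite. For each permutation $f$ of $\Omega$ and each formula $A$ of MRL there is $n\geq 1$ such that $A\Leftrightarrow f^n(A)$, where $f^n(A)$ denotes $\neg_f(\neg_f(\cdots\neg_f(A)\cdots))$ with $n$ applications of $\neg_f$.
   Context: Fix a set $\Omega$ of roles. A role set is a subset $R\subseteq\Omega$; $\overline{R}=\Omega\setminus R$; $R_1\uplus\cdots\uplus R_n=\Omega$ means the $R_i$ are pairwise disjoint with union $\Omega$. An ultrafilter on $\Omega$ is a family $\mathcal U$ of subsets of $\Omega$ with $\Omega\in\mathcal U$, closed upward and under binary intersection, and containing $R$ or $\overline R$ for every $R$. For an endomorphism $f:\Omega\to\Omega$, $f^{ -1}(R)=\{r\mid f(r)\in R\}$. Formulas of MRL, over first-order terms $t$ and variables $x$: $A,B::=a\mid\neg_f(A)\mid A\wedge_{\mathcal U}B\mid\forall_{\mathcal U}(\lambda x.A)$ ($a$ primitive formulas, $f$ endomorphisms of $\Omega$, $\mathcal U$ ultrafilters); $A[x:=t]$ is substitution. An i-formula is $R\{A\}$ with $R\subseteq\Omega$; a sequent $\Gamma$ is a finite multiset of i-formulas. Derivable sequents $\vdash\Gamma$ are generated by: (Id) $\vdash R_1\{a\},\ldots,R_n\{a\}$ whenever $R_1\uplus\cdots\uplus R_n=\Omega$; (Weaken) from $\Gamma$ infer $\Gamma,R\{A\}$; (Contract) from $\Gamma,R\{A\},R\{A\}$ infer $\Gamma,R\{A\}$; ($\neg$) from $\Gamma,f^{ -1}(R)\{A\}$ infer $\Gamma,R\{\neg_f(A)\}$;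 ($\wedge$-neg-l/r) if $R\notin\mathcal U$, from $\Gamma,R\{A\}$ (resp. $\Gamma,R\{B\}$) infer $\Gamma,R\{A\wedge_{\mathcal U}B\}$; ($\wedge$-pos) if $R\in\mathcal U$, from $\Gamma,R\{A\}$ and $\Gamma,R\{B\}$ infer $\Gamma,R\{A\wedge_{\mathcal U}B\}$; ($\forall$-neg) if $R\notin\mathcal U$, from $\Gamma,R\{A[x:=t]\}$ infer $\Gamma,R\{\forall_{\mathcal U}(\lambda x.A)\}$; ($\forall$-pos) if $R\in\mathcal U$ and $x$ not free in $\Gamma$, from $\Gamma,R\{A\}$ infer $\Gamma,R\{\forall_{\mathcal U}(\lambda x.A)\}$. For formulas $A,B$, $A\Rightarrow B$ means: for every role set $R$ and every sequent $\Gamma$, if $\vdash\Gamma,R\{A\}$ is derivable then $\vdash\Gamma,R\{B\}$ is derivable; $A\Leftrightarrow B$ means $A\Rightarrow B$ and $B\Rightarrow A$. -}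

module Defs where

open import Data.Nat using (ℕ; zero; suc)
open import Data.Bool using (Bool; true; false; if_then_else_)
open import Data.Fin using (Fin)
open import Data.Fin.Subset using (Subset; ⊤; ∁; _∩_; _⊆_; _∈_)
open import Data.Vec using (Vec; []; _∷_; lookup; tabulate)
open import Data.List using (List; []; _∷_; map; length)
import Data.List as L
open import Data.List.Relation.Binary.Permutation.Propositional using (_↭_)
open import Data.Product using (_×_; _,_; ∃; ∃-syntax; Σ)
open import Data.Sum using (_⊎_)
open import Data.Empty using (⊥)
open import Relation.Binary.PropositionalEquality using (_≡_; _≢_)

-- Roles: Ω = Fin k (a finite set of roles with k elements).
-- Role sets: Data.Fin.Subset (Vec Bool k), a canonical representation.

-- Families of role sets, represented canonically by their characteristic
-- table (a binary trie indexed by subsets), so that equal families are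
-- propositionally equal.

Family : ℕ → Set
Family zero    = Bool
Family (suc n) = Family n × Family n

memF : ∀ {n} → Family n → Subset n → Bool
memF {zero}  b       []      = b
memF {suc n} (F₀ , F₁) (x ∷ R) = if x then memF F₁ R else memF F₀ R

_∈F_ : ∀ {n} → Subset n → Family n → Set
R ∈F U = memF U R ≡ true

_∉F_ : ∀ {n} → Subset n → Family n → Set
R ∉F U = memF U R ≡ false

record IsUltrafilter {k : ℕ} (U : Family k) : Set where
  field
    has-Ω     : ⊤ ∈F U
    upward    : ∀ (R S : Subset k) → R ⊆ S → R ∈F U → S ∈F U
    intersect : ∀ (R S : Subset k) → R ∈F U → S ∈F U → (R ∩ S) ∈F U
    ultra     : ∀ (R : Subset k) → (R ∈F U) ⊎ (∁ R ∈F U)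

-- An ultrafilter; the proof is irrelevant, so ultrafilters are equal iff
-- their underlying families are.
record Ultrafilter (k : ℕ) : Set where
  constructor ultrafilter
  field
    family : Family k
    .isUltrafilter : IsUltrafilter family
open Ultrafilter public

-- Endomorphisms of Ω, represented canonically by their table.

Endo : ℕ → Set
Endo k = Vec (Fin k) k

app : ∀ {k} → Endo k → Fin k → Fin k
app f r = lookup f r

preimage : ∀ {k} → Endo k → Subset k → Subset k
preimage f R = tabulate (λ r → lookup R (app f r))

IsPermutation : ∀ {k} → Endo k → Set
IsPermutation {k} f =
  Σ (Endo k) λ g → (∀ r → app g (app f r) ≡ r) × (∀ r → app f (app g r) ≡ r)

data Term : Set where
  var : ℕ → Term
  fn  : ℕ → List Term → Term

data Atom : Set where
  pred : ℕ → List Term → Atom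

Ren : Set
Ren = ℕ → ℕ

Sub : Set
Sub = ℕ → Term

liftR : Ren → Ren
liftR ρ zero    = zero
liftR ρ (suc i) = suc (ρ i)

renT  : Ren → Term → Term
renTs : Ren → List Term → List Term
renT ρ (var i)   = var (ρ i)
renT ρ (fn s ts) = fn s (renTs ρ ts)
renTs ρ []       = []
renTs ρ (t ∷ ts) = renT ρ t ∷ renTs ρ ts

liftS : Sub → Sub
liftS σ zero    = var zero
liftS σ (suc i) = renT suc (σ i)

subT  : Sub → Term → Term
subTs : Sub → List Term → List Term
subT σ (var i)   = σ i
subT σ (fn s ts) = fn s (subTs σ ts)
subTs σ []       = []
subTs σ (t ∷ ts) = subT σ t ∷ subTs σ ts

renA : Ren → Atom → Atom
renA ρ (pred p ts) = pred p (renTs ρ ts)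

subA : Sub → Atom → Atom
subA σ (pred p ts) = pred p (subTs σ ts)

-- MRL formulas (∀ binds de Bruijn variable 0)

data Formula (k : ℕ) : Set where
  atom : Atom → Formula k
  ¬[_]_ : Endo k → Formula k → Formula k
  ∧[_] : Ultrafilter k → Formula k → Formula k → Formula k
  ∀[_] : Ultrafilter k → Formula k → Formula k

ren : ∀ {k} → Ren → Formula k → Formula k
ren ρ (atom a)    = atom (renA ρ a)
ren ρ (¬[ f ] A)  = ¬[ f ] ren ρ A
ren ρ (∧[ U ] A B) = ∧[ U ] (ren ρ A) (ren ρ B)
ren ρ (∀[ U ] A)  = ∀[ U ] (ren (liftR ρ) A)

sub : ∀ {k} → Sub → Formula k → Formula k
sub σ (atom a)    = atom (subA σ a)
sub σ (¬[ f ] A)  = ¬[ f ] sub σ A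
sub σ (∧[ U ] A B) = ∧[ U ] (sub σ A) (sub σ B)
sub σ (∀[ U ] A)  = ∀[ U ] (sub (liftS σ) A)

single : Term → Sub
single t zero    = t
single t (suc i) = var i

_[0:=_] : ∀ {k} → Formula k → Term → Formula k
A [0:= t ] = sub (single t) A

-- i-formulas and sequents (finite multisets = lists up to permutation)

IFormula : ℕ → Set
IFormula k = Subset k × Formula k

Sequent : ℕ → Set
Sequent k = List (IFormula k)

shiftI : ∀ {k} → IFormula k → IFormula k
shiftI (R , A) = R , ren suc A

IsPartition : ∀ {k} → List (Subset k) → Set
IsPartition {k} Rs =
  (∀ (i j : Fin (length Rs)) → i ≢ j → ∀ (r : Fin k) →
     r ∈ L.lookup Rs i → r ∈ L.lookup Rs j → ⊥)
  × (∀ (r : Fin k) → ∃[ i ] (r ∈ L.lookup Rs i))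

infix 4 ⊢_
data ⊢_ {k : ℕ} : Sequent k → Set where
  Id       : (Rs : List (Subset k)) → IsPartition Rs → (a : Atom) →
             ⊢ map (λ R → R , atom a) Rs
  Exchange : ∀ {Γ Δ} → Γ ↭ Δ → ⊢ Γ → ⊢ Δ
  Weaken   : ∀ {Γ R A} → ⊢ Γ → ⊢ (R , A) ∷ Γ
  Contract : ∀ {Γ R A} → ⊢ (R , A) ∷ (R , A) ∷ Γ → ⊢ (R , A) ∷ Γ
  Neg      : ∀ {Γ R A} {f : Endo k} →
             ⊢ (preimage f R , A) ∷ Γ → ⊢ (R , ¬[ f ] A) ∷ Γ
  AndNegL  : ∀ {Γ R A B} {U : Ultrafilter k} → R ∉F family U →
             ⊢ (R , A) ∷ Γ → ⊢ (R , ∧[ U ] A B) ∷ Γ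
  AndNegR  : ∀ {Γ R A B} {U : Ultrafilter k} → R ∉F family U →
             ⊢ (R , B) ∷ Γ → ⊢ (R , ∧[ U ] A B) ∷ Γ
  AndPos   : ∀ {Γ R A B} {U : Ultrafilter k} → R ∈F family U →
             ⊢ (R , A) ∷ Γ → ⊢ (R , B) ∷ Γ → ⊢ (R , ∧[ U ] A B) ∷ Γ
  AllNeg   : ∀ {Γ R A} {U : Ultrafilter k} → R ∉F family U → (t : Term) →
             ⊢ (R , A [0:= t ]) ∷ Γ → ⊢ (R , ∀[ U ] A) ∷ Γ
  -- eigenvariable condition: the fresh variable is 0, Γ is shifted
  AllPos   : ∀ {Γ R A} {U : Ultrafilter k} → R ∈F family U →
             ⊢ (R , A) ∷ map shiftI Γ → ⊢ (R , ∀[ U ] A) ∷ Γ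

_⇒_ : ∀ {k} → Formula k → Formula k → Set
_⇒_ {k} A B = ∀ (R : Subset k) (Γ : Sequent k) → ⊢ (R , A) ∷ Γ → ⊢ (R , B) ∷ Γ

_⇔_ : ∀ {k} → Formula k → Formula k → Set
A ⇔ B = (A ⇒ B) × (B ⇒ A)

negIter : ∀ {k} → Endo k → ℕ → Formula k → Formula k
negIter f zero    A = A
negIter f (suc n) A = ¬[ f ] negIter f n A

{-# OPTIONS --safe #-}
-- The negation rule is invertible, so R{fⁿ(A)} is derivable exactly when (fⁿ)⁻¹(R){A} is.
-- A permutation of the finite set Ω has a power fⁿ = id with n ≥ 1 (a common multiple of
-- the orbit lengths), and for that n both i-formulas carry the same role set R.
module Submission where

open import Defs
open import Data.Nat using (ℕ; _≥_; zero; suc; _+_; _*_; _∸_; s≤s; z≤n)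
open import Data.Nat.Properties using (+-suc; *-comm; *-mono-≤; m+[n∸m]≡n; n<1+n)
open import Data.Product using (Σ; _×_; _,_; ∃-syntax)
open import Data.List using (List; []; _∷_; map)
open import Data.List.Relation.Binary.Pointwise as Pointwise using (Pointwise; []; _∷_)
import Data.List.Relation.Binary.Permutation.Propositional as ↭
open ↭ using (_↭_)
open import Data.Fin using (Fin; toℕ) renaming (zero to fzero; suc to fsuc)
open import Data.Fin.Properties using (pigeonhole)
open import Data.Fin.Subset using (Subset)
open import Data.Vec using (lookup; tabulate)
open import Data.Vec.Properties using (tabulate∘lookup; tabulate-cong; lookup∘tabulate)
open import Function using (_∘_)
open import Function.Definitions using (Injective)
open import Relation.Binary.Core using (REL)
open import Relation.Binary.PropositionalEquality

module _ {a b r} {A : Set a} {B : Set b} {R : REL A B r} where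

  ↭-Pointwise-commute : ∀ {xs ys ys′} → xs ↭ ys → Pointwise R ys ys′ →
                        ∃[ xs′ ] Pointwise R xs xs′ × xs′ ↭ ys′
  ↭-Pointwise-commute ↭.refl         rs           = _ , rs , ↭.refl
  ↭-Pointwise-commute (↭.prep x p)   (r ∷ rs)     with ↭-Pointwise-commute p rs
  ... | _ , rs′ , p′ = _ , r ∷ rs′ , ↭.prep _ p′
  ↭-Pointwise-commute (↭.swap x y p) (r ∷ s ∷ rs) with ↭-Pointwise-commute p rs
  ... | _ , rs′ , p′ = _ , s ∷ r ∷ rs′ , ↭.swap _ _ p′
  ↭-Pointwise-commute (↭.trans p q)  rs           with ↭-Pointwise-commute q rs
  ... | _ , rs′ , q′ with ↭-Pointwise-commute p rs′
  ...   | _ , rs″ , p′ = _ , rs″ , ↭.trans p′ q′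

data Unfold¬ {k : ℕ} : IFormula k → IFormula k → Set where
  keep  : ∀ {x} → Unfold¬ x x
  strip : ∀ {R f A} → Unfold¬ (R , ¬[ f ] A) (preimage f R , A)

Unfold¬-shift : ∀ {k} {x y : IFormula k} → Unfold¬ x y → Unfold¬ (shiftI x) (shiftI y)
Unfold¬-shift keep  = keep
Unfold¬-shift strip = strip

Unfold¬-atoms : ∀ {k} (Rs : List (Subset k)) (a : Atom) {Δ} →
                Pointwise Unfold¬ (map (λ R → R , atom a) Rs) Δ → Δ ≡ map (λ R → R , atom a) Rs
Unfold¬-atoms []       a []          = refl
Unfold¬-atoms (R ∷ Rs) a (keep ∷ us) = cong (_ ∷_) (Unfold¬-atoms Rs a us)

-- Side formulas are copied unchanged into the premises, so an unfolding is carried up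
-- through every rule; at the Neg rule of the unfolded formula it just removes that rule.
⊢-Unfold¬ : ∀ {k} {Δ Δ′ : Sequent k} → ⊢ Δ → Pointwise Unfold¬ Δ Δ′ → ⊢ Δ′
⊢-Unfold¬ (Id Rs P a)      us           rewrite Unfold¬-atoms Rs a us = Id Rs P a
⊢-Unfold¬ (Exchange p d)   us           with ↭-Pointwise-commute p us
... | _ , us′ , p′ = Exchange p′ (⊢-Unfold¬ d us′)
⊢-Unfold¬ (Weaken d)       (u ∷ us)     = Weaken (⊢-Unfold¬ d us)
⊢-Unfold¬ (Contract d)     (u ∷ us)     = Contract (⊢-Unfold¬ d (u ∷ u ∷ us))
⊢-Unfold¬ (Neg d)          (keep ∷ us)  = Neg (⊢-Unfold¬ d (keep ∷ us))
⊢-Unfold¬ (Neg d)          (strip ∷ us) = ⊢-Unfold¬ d (keep ∷ us)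
⊢-Unfold¬ (AndNegL R∉ d)   (keep ∷ us)  = AndNegL R∉ (⊢-Unfold¬ d (keep ∷ us))
⊢-Unfold¬ (AndNegR R∉ d)   (keep ∷ us)  = AndNegR R∉ (⊢-Unfold¬ d (keep ∷ us))
⊢-Unfold¬ (AndPos R∈ d e)  (keep ∷ us)  = AndPos R∈ (⊢-Unfold¬ d (keep ∷ us)) (⊢-Unfold¬ e (keep ∷ us))
⊢-Unfold¬ (AllNeg R∉ t d)  (keep ∷ us)  = AllNeg R∉ t (⊢-Unfold¬ d (keep ∷ us))
⊢-Unfold¬ (AllPos R∈ d)    (keep ∷ us)  =
  AllPos R∈ (⊢-Unfold¬ d (keep ∷ Pointwise.map⁺ shiftI shiftI (Pointwise.map Unfold¬-shift us)))

Neg⁻¹ : ∀ {k} {R : Subset k} {f A Γ} → ⊢ (R , ¬[ f ] A) ∷ Γ → ⊢ (preimage f R , A) ∷ Γ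
Neg⁻¹ d = ⊢-Unfold¬ d (strip ∷ Pointwise.refl keep)

⊢-resp-role : ∀ {k} {R S : Subset k} {A Γ} → R ≡ S → ⊢ (R , A) ∷ Γ → ⊢ (S , A) ∷ Γ
⊢-resp-role refl d = d

module _ {k : ℕ} where

  open import Function.Endo.Propositional (Fin k) using (_^_)

  -- preimage f is app f ⁻¹_ definitionally.
  infix 6 _⁻¹_
  _⁻¹_ : (Fin k → Fin k) → Subset k → Subset k
  g ⁻¹ R = tabulate (λ r → lookup R (g r))

  ⁻¹-∘ : ∀ g h (R : Subset k) → g ⁻¹ (h ⁻¹ R) ≡ (h ∘ g) ⁻¹ R
  ⁻¹-∘ g h R = tabulate-cong (λ r → lookup∘tabulate _ (g r))

  ⁻¹-id : ∀ {g} → (∀ r → g r ≡ r) → (R : Subset k) → g ⁻¹ R ≡ R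
  ⁻¹-id g≗id R = trans (tabulate-cong (cong (lookup R) ∘ g≗id)) (tabulate∘lookup R)

  Neg^ : ∀ (f : Endo k) n {R A Γ} → ⊢ ((app f ^ n) ⁻¹ R , A) ∷ Γ → ⊢ (R , negIter f n A) ∷ Γ
  Neg^ f zero    {R} d = ⊢-resp-role (tabulate∘lookup R) d
  Neg^ f (suc n) {R} d = Neg (Neg^ f n (⊢-resp-role (sym (⁻¹-∘ (app f ^ n) (app f) R)) d))

  Neg^⁻¹ : ∀ (f : Endo k) n {R A Γ} → ⊢ (R , negIter f n A) ∷ Γ → ⊢ ((app f ^ n) ⁻¹ R , A) ∷ Γ
  Neg^⁻¹ f zero    {R} d = ⊢-resp-role (sym (tabulate∘lookup R)) d
  Neg^⁻¹ f (suc n) {R} d = ⊢-resp-role (⁻¹-∘ (app f ^ n) (app f) R) (Neg^⁻¹ f n (Neg⁻¹ d))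

  ⇔-negIter : ∀ {f : Endo k} {n} → (∀ r → (app f ^ n) r ≡ r) → (A : Formula k) → A ⇔ negIter f n A
  ⇔-negIter {f} {n} fⁿ≗id A =
      (λ R Γ d → Neg^ f n (⊢-resp-role (sym (⁻¹-id fⁿ≗id R)) d))
    , (λ R Γ d → ⊢-resp-role (⁻¹-id fⁿ≗id R) (Neg^⁻¹ f n d))

common-multiple : ∀ {m} (P : Fin m → ℕ → Set) → (∀ i c {n} → P i n → P i (c * n)) →
                  (∀ i → ∃[ n ] n ≥ 1 × P i n) → ∃[ n ] n ≥ 1 × (∀ i → P i n)
common-multiple {zero}  P P-mult hasP = 1 , s≤s z≤n , λ ()
common-multiple {suc m} P P-mult hasP with hasP fzero | common-multiple (P ∘ fsuc) (P-mult ∘ fsuc) (hasP ∘ fsuc)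
... | n₀ , n₀≥1 , p₀ | n , n≥1 , ps = n₀ * n , *-mono-≤ n₀≥1 n≥1 , all
  where
  all : ∀ i → P i (n₀ * n)
  all fzero    = subst (P fzero) (*-comm n n₀) (P-mult fzero n p₀)
  all (fsuc i) = P-mult (fsuc i) n₀ (ps i)

module _ {k : ℕ} {g : Fin k → Fin k} where

  open import Function.Endo.Propositional (Fin k) using (_^_; ^-homo)

  ^-fixes-multiples : ∀ n c {r} → (g ^ n) r ≡ r → (g ^ (c * n)) r ≡ r
  ^-fixes-multiples n zero    fix = refl
  ^-fixes-multiples n (suc c) {r} fix = begin
    (g ^ (n + c * n)) r       ≡⟨ cong-app (^-homo g n (c * n)) r ⟩
    (g ^ n) ((g ^ (c * n)) r) ≡⟨ cong (g ^ n) (^-fixes-multiples n c fix) ⟩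
    (g ^ n) r                 ≡⟨ fix ⟩
    r                         ∎
    where open ≡-Reasoning

  module _ (g-inj : Injective _≡_ _≡_ g) where

    ^-injective : ∀ n → Injective _≡_ _≡_ (g ^ n)
    ^-injective zero    eq = eq
    ^-injective (suc n) eq = ^-injective n (g-inj eq)

    -- Among g⁰ r, …, gᵏ r two coincide, say gⁱ r = gʲ r with i < j; cancelling gⁱ gives g^(j-i) r = r.
    injective⇒periodic : ∀ r → ∃[ n ] n ≥ 1 × (g ^ n) r ≡ r
    injective⇒periodic r with pigeonhole (n<1+n k) (λ i → (g ^ toℕ i) r)
    ... | i , j , i<j , gⁱr≡gʲr = suc d , s≤s z≤n , ^-injective (toℕ i) (begin
        (g ^ toℕ i) ((g ^ suc d) r) ≡⟨ cong-app (^-homo g (toℕ i) (suc d)) r ⟨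
        (g ^ (toℕ i + suc d)) r     ≡⟨ cong (λ m → (g ^ m) r) (trans (+-suc (toℕ i) d) (m+[n∸m]≡n i<j)) ⟩
        (g ^ toℕ j) r               ≡⟨ gⁱr≡gʲr ⟨
        (g ^ toℕ i) r               ∎)
      where
      open ≡-Reasoning
      d = toℕ j ∸ suc (toℕ i)

    injective⇒^-identity : ∃[ n ] n ≥ 1 × (∀ r → (g ^ n) r ≡ r)
    injective⇒^-identity = common-multiple (λ r n → (g ^ n) r ≡ r) (λ r c {n} → ^-fixes-multiples n c) injective⇒periodic

permutation⇒injective : ∀ {k} {f : Endo k} → IsPermutation f → Injective _≡_ _≡_ (app f)
permutation⇒injective {f = f} (f⁻¹ , f⁻¹∘f≗id , _) {x} {y} fx≡fy = begin
  x                 ≡⟨ f⁻¹∘f≗id x ⟨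
  app f⁻¹ (app f x) ≡⟨ cong (app f⁻¹) fx≡fy ⟩
  app f⁻¹ (app f y) ≡⟨ f⁻¹∘f≗id y ⟩
  y                 ∎
  where open ≡-Reasoning

proposition4 : (k : ℕ) (f : Endo k) → IsPermutation f → (A : Formula k) →
    Σ ℕ (λ n → (n ≥ 1) × (A ⇔ negIter f n A))
proposition4 k f f-perm A with injective⇒^-identity (permutation⇒injective {f = f} f-perm)
... | n , n≥1 , fⁿ≗id = n , n≥1 , ⇔-negIter fⁿ≗id A
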